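{- For every even $g\ge 4$, ${\rm fasd}(3,g)\le g-\left\lfloor \frac g4-1\right\rfloor$. For every odd $g\ge 7$, ${\rm fasd}(3,g)\le g-\left\lfloor\frac{g-7}{4}\right\rfloor$. Moreover, ${\rm fasd}(3,g)<g$ for all $g\ge 8$.
   Context: An oriented graph is a digraph without loops, multiple arcs or directed $2$-cycles. Degree = in-degree + out-degree; directed girth = minimum length of a directed cycle ($\infty$ if none). For a digraph $D$, ${\rm fasd}(D)$ is the maximum number $t$ such that $A(D)$ can be partitioned into $t$ feedback arc sets (sets of arcs whose removal makes $D$ acyclic), with ${\rm fasd}(D)=\infty$ if $D$ is acyclic. ${\rm fasd}(\Delta,g)$ is the minimum of ${\rm fasd}(D)$ over all oriented graphs $D$ with maximum degree at most $\Delta$ and directed girth at least $g$. -}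

module Defs where

open import Data.Nat using (ℕ; zero; suc; _+_; _≤_)
open import Data.Bool using (Bool; true; false; if_then_else_)
open import Data.Fin using (Fin; zero; suc; inject₁; fromℕ)
open import Data.List using (List; map; allFin)
open import Data.Nat.ListAction using (sum)
open import Data.Product using (Σ; _×_; ∃)
open import Relation.Nullary using (¬_)
open import Relation.Binary.PropositionalEquality using (_≡_; _≢_)
open import Function.Definitions using (Injective)

record OrientedGraph : Set where
  field
    n      : ℕ
    arc    : Fin n → Fin n → Bool
    noLoop : ∀ v → arc v v ≡ false
    no2cyc : ∀ u v → arc u v ≡ true → arc v u ≡ false

open OrientedGraph public

Arc : (D : OrientedGraph) → Fin (n D) → Fin (n D) → Set
Arc D u v = arc D u v ≡ true

outdeg indeg deg : (D : OrientedGraph) → Fin (n D) → ℕ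
outdeg D u = sum (map (λ v → if arc D u v then 1 else 0) (allFin (n D)))
indeg  D u = sum (map (λ v → if arc D v u then 1 else 0) (allFin (n D)))
deg D u = outdeg D u + indeg D u

MaxDegreeAtMost : ℕ → OrientedGraph → Set
MaxDegreeAtMost Δ D = ∀ u → deg D u ≤ Δ

-- A directed cycle of length (suc m) in a relation R on Fin k:
-- distinct vertices f 0, …, f m with R (f i) (f (i+1)) and R (f m) (f 0).
record DirCycle {k : ℕ} (R : Fin k → Fin k → Set) (m : ℕ) : Set where
  field
    vtx   : Fin (suc m) → Fin k
    inj   : Injective _≡_ _≡_ vtx
    step  : ∀ (i : Fin m) → R (vtx (inject₁ i)) (vtx (suc i))
    close : R (vtx (fromℕ m)) (vtx zero)

-- directed girth ≥ g (vacuous when there is no directed cycle: girth ∞)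
DirGirthAtLeast : ℕ → OrientedGraph → Set
DirGirthAtLeast g D = ∀ m → DirCycle (Arc D) m → g ≤ suc m

IsFAS : (D : OrientedGraph) → (Fin (n D) → Fin (n D) → Set) → Set
IsFAS D F = ∀ m → ¬ DirCycle (λ u v → Arc D u v × ¬ F u v) m

-- A(D) can be partitioned into t feedback arc sets: a colouring of the arcs
-- with t colours (values on non-arcs are irrelevant) whose colour classes
-- are all feedback arc sets.
FASPartition : OrientedGraph → ℕ → Set
FASPartition D t =
  Σ (Fin (n D) → Fin (n D) → Fin t) λ c →
    ∀ (i : Fin t) → IsFAS D (λ u v → Arc D u v × c u v ≡ i)

-- fasd(D) ≤ b  (fasd(D) = max t with FASPartition D t; ∞ if D is acyclic,
-- in which case FASPartition D t holds for every t)
FasdAtMost : OrientedGraph → ℕ → Set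
FasdAtMost D b = ¬ FASPartition D (suc b)

-- fasd(Δ, g) ≤ b : the minimum over oriented graphs with maximum degree ≤ Δ
-- and directed girth ≥ g is at most b, i.e. some such graph has fasd ≤ b.
FasdΔgAtMost : ℕ → ℕ → ℕ → Set
FasdΔgAtMost Δ g b =
  ∃ λ (D : OrientedGraph) → MaxDegreeAtMost Δ D × DirGirthAtLeast g D × FasdAtMost D b

module Submission where

-- The witness is the oriented graph Θ(P, σ) made of three directed paths with P, P and P − σ arcs, the last
-- vertex of each path sending an arc to the first vertex of each of the other two. Every vertex has degree at
-- most 3. A directed cycle cannot stay inside one path, so it runs through at least two whole paths together with
-- the jumps between them, which gives directed girth at least (P + 1) + (P + 1 − σ). For any two paths, the two
-- paths and the two jumps between them form a directed cycle; each colour class of a partition into feedback arc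
-- sets meets all three of these cycles, but no arc lies on all three, so every class contains two arcs and hence
-- 2 · fasd(Θ) ≤ |A(Θ)| = 3P + 6 − σ. Taking σ = g mod 2 and P = ⌊(g − 1)/2⌋ gives the three bounds.

open import Defs
open import Data.Nat using (ℕ; zero; suc; pred; _+_; _*_; _∸_; _≤_; _<_; z≤n; s≤s; _≤?_; _/_; _%_)
open import Data.Nat.Properties
open import Data.Nat.DivMod using (_mod_; m≤n⇒m%n≡m; m≡m%n+[m/n]*n; m/n*n≤m; m≥n⇒m/n>0; m%n<n)
open import Data.Nat.ListAction using (sum)
open import Data.Nat.Tactic.RingSolver using (solve-∀)
open import Data.Bool using (Bool; true; false; if_then_else_)
open import Data.Bool.Properties using () renaming (_≟_ to _≟ᵇ_)
open import Data.Fin using (Fin; zero; suc; inject₁; fromℕ; toℕ; splitAt; join; combine; remQuot;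
  punchIn; punchOut; fromℕ<; inject≤)
  renaming (_≟_ to _≟ᶠ_)
open import Data.Fin.Properties using (any?; toℕ-fromℕ; toℕ-inject₁; toℕ-injective; toℕ≤pred[n]; toℕ<n;
  join-splitAt; injective⇒≤; toℕ-fromℕ<; remQuot-combine; combine-remQuot; combine-injective;
  punchIn-punchOut; punchOut-injective; inject≤-injective; toℕ-inject≤)
open import Data.Fin.Relation.Unary.Top using (view; ‵fromℕ; ‵inject₁; view-fromℕ)
open import Data.List using (List; []; _∷_; length; map; allFin; tabulate)
open import Data.List.Properties using (map-tabulate; length-map)
open import Data.List.Membership.Propositional using (_∈_)
open import Data.List.Membership.Propositional.Properties using (∈-map⁺; ∈-allFin)
open import Data.List.Relation.Unary.Any using (here; there)
open import Data.Product using (Σ; ∃; _×_; _,_; proj₁; proj₂; uncurry)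
open import Data.Product.Properties using (≡-dec)
open import Data.Sum using (_⊎_; inj₁; inj₂; [_,_]′)
import Data.Sum as Sum
open import Data.Empty using (⊥; ⊥-elim)
open import Function using (_∘_)
open import Function.Definitions using (Injective)
open import Relation.Nullary using (¬_; Dec; yes; no; does)
open import Relation.Nullary.Decidable using (dec-true; dec-false; map′; _×-dec_)
open import Relation.Binary using (Decidable)
open import Relation.Binary.PropositionalEquality

predecessors : ∀ {n} → List (Fin (suc n)) → List (Fin n)
predecessors []           = []
predecessors (zero  ∷ xs) = predecessors xs
predecessors (suc x ∷ xs) = x ∷ predecessors xs

∈-predecessors : ∀ {n} {v : Fin n} xs → suc v ∈ xs → v ∈ predecessors xs
∈-predecessors (zero  ∷ xs) (there p)   = ∈-predecessors xs p
∈-predecessors (suc x ∷ xs) (here refl) = here refl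
∈-predecessors (suc x ∷ xs) (there p)   = there (∈-predecessors xs p)

length-predecessors : ∀ {n} (xs : List (Fin (suc n))) → length (predecessors xs) ≤ length xs
length-predecessors []           = z≤n
length-predecessors (zero  ∷ xs) = m≤n⇒m≤1+n (length-predecessors xs)
length-predecessors (suc x ∷ xs) = s≤s (length-predecessors xs)

length-predecessors-< : ∀ {n} (xs : List (Fin (suc n))) → zero ∈ xs → length (predecessors xs) < length xs
length-predecessors-< (zero  ∷ xs) _         = s≤s (length-predecessors xs)
length-predecessors-< (suc x ∷ xs) (there p) = s≤s (length-predecessors-< xs p)

indicator : Bool → ℕ
indicator b = if b then 1 else 0

trueCount-tabulate-≤ : ∀ {n} (f : Fin n → Bool) (xs : List (Fin n)) →
  (∀ v → f v ≡ true → v ∈ xs) → sum (tabulate (λ v → indicator (f v))) ≤ length xs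
trueCount-tabulate-≤ {zero}  f xs _    = z≤n
trueCount-tabulate-≤ {suc n} f xs f⊆xs =
  headBound (f zero) (f⊆xs zero)
    (trueCount-tabulate-≤ (f ∘ suc) (predecessors xs) (λ v e → ∈-predecessors xs (f⊆xs (suc v) e)))
  where
  headBound : ∀ {r} b → (b ≡ true → zero ∈ xs) → r ≤ length (predecessors xs) →
              indicator b + r ≤ length xs
  headBound true  zero∈xs r≤ = ≤-trans (s≤s r≤) (length-predecessors-< xs (zero∈xs refl))
  headBound false _       r≤ = ≤-trans r≤ (length-predecessors xs)

trueCount-≤ : ∀ {n} (f : Fin n → Bool) (xs : List (Fin n)) →
  (∀ v → f v ≡ true → v ∈ xs) → sum (map (λ v → indicator (f v)) (allFin n)) ≤ length xs
trueCount-≤ f xs f⊆xs rewrite map-tabulate (λ v → v) (λ v → indicator (f v)) = trueCount-tabulate-≤ f xs f⊆xs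

does⇒ : ∀ {A : Set} (a? : Dec A) → does a? ≡ true → A
does⇒ (yes a) _ = a

module _ {n : ℕ} {R : Fin n → Fin n → Set} (R? : Decidable R)
         (R-irrefl : ∀ {u} → ¬ R u u) (R-asym : ∀ {u v} → R u v → ¬ R v u) where

  fromRelation : OrientedGraph
  fromRelation = record
    { n      = n
    ; arc    = λ u v → does (R? u v)
    ; noLoop = λ u → dec-false (R? u u) R-irrefl
    ; no2cyc = λ u v uv → dec-false (R? v u) (R-asym (does⇒ (R? u v) uv)) }

  arc⇒rel : ∀ {u v} → Arc fromRelation u v → R u v
  arc⇒rel {u} {v} = does⇒ (R? u v)

  rel⇒arc : ∀ {u v} → R u v → Arc fromRelation u v
  rel⇒arc {u} {v} = dec-true (R? u v)

-- Directed cycles as closed walks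

cyclicSuc : ∀ {m} → Fin (suc m) → Fin (suc m)
cyclicSuc i with view i
... | ‵fromℕ     = zero
... | ‵inject₁ j = suc j

toℕ-cyclicSuc : ∀ {m} (i : Fin (suc m)) → toℕ i < m → toℕ (cyclicSuc i) ≡ suc (toℕ i)
toℕ-cyclicSuc i i<m with view i
... | ‵fromℕ     = ⊥-elim (<-irrefl (toℕ-fromℕ _) i<m)
... | ‵inject₁ j = cong suc (sym (toℕ-inject₁ j))

cyclicSuc-fromℕ : ∀ m → cyclicSuc (fromℕ m) ≡ zero
cyclicSuc-fromℕ m rewrite view-fromℕ m = refl

cycleIndex : ∀ {m} → ℕ → Fin (suc m)
cycleIndex zero    = zero
cycleIndex (suc i) = cyclicSuc (cycleIndex i)

toℕ-cycleIndex : ∀ {m} i → i ≤ m → toℕ (cycleIndex {m} i) ≡ i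
toℕ-cycleIndex zero        _   = refl
toℕ-cycleIndex {m} (suc i) i<m = trans (toℕ-cyclicSuc (cycleIndex i) (subst (_< m) (sym IH) i<m)) (cong suc IH)
  where
  IH : toℕ (cycleIndex {m} i) ≡ i
  IH = toℕ-cycleIndex i (<⇒≤ i<m)

cycleIndex-periodic : ∀ {m} i → cycleIndex {m} (i + suc m) ≡ cycleIndex i
cycleIndex-periodic {m} zero    = trans (cong cyclicSuc lastIndex) (cyclicSuc-fromℕ m)
  where
  lastIndex : cycleIndex m ≡ fromℕ m
  lastIndex = toℕ-injective (trans (toℕ-cycleIndex m ≤-refl) (sym (toℕ-fromℕ m)))
cycleIndex-periodic     (suc i) = cong cyclicSuc (cycleIndex-periodic i)

module _ {k : ℕ} {R : Fin k → Fin k → Set} {m : ℕ} (C : DirCycle R m) where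
  open DirCycle C

  step-cyclicSuc : ∀ i → R (vtx i) (vtx (cyclicSuc i))
  step-cyclicSuc i with view i
  ... | ‵fromℕ     = close
  ... | ‵inject₁ j = step j

  closedWalk : ℕ → Fin k
  closedWalk i = vtx (cycleIndex i)

  closedWalk-step : ∀ i → R (closedWalk i) (closedWalk (suc i))
  closedWalk-step i = step-cyclicSuc (cycleIndex i)

  closedWalk-periodic : ∀ i → closedWalk (suc m + i) ≡ closedWalk i
  closedWalk-periodic i = cong vtx (trans (cong cycleIndex (+-comm (suc m) i)) (cycleIndex-periodic i))

-- height u is the number of steps from u to the next change of class; Entry marks the first vertex after one.
module LayeredWalk {X C : Set} (R : X → X → Set) (class : X → C) (Entry : X → Set) (height : X → ℕ)
  (arc-cases : ∀ {u v} → R u v →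
     (Entry v × height u ≡ 1 × class v ≢ class u) ⊎
     (¬ Entry v × height u ≡ suc (height v) × class v ≡ class u))
  {g : ℕ} (gap : ∀ {u v} → Entry u → Entry v → class u ≢ class v → g ≤ height u + height v)
  (w : ℕ → X) (w-step : ∀ i → R (w i) (w (suc i))) where

  height-suc : ∀ i → ∃ λ k → height (w i) ≡ suc k
  height-suc i with arc-cases (w-step i)
  ... | inj₁ (_ , h≡1 , _) = 0 , h≡1
  ... | inj₂ (_ , h≡ , _)  = _ , h≡

  nextEntry : ∀ k i → height (w i) ≡ suc k →
    Entry (w (suc k + i)) × class (w (suc k + i)) ≢ class (w i) × (∀ j → Entry (w (suc j + i)) → k ≤ j)
  nextEntry k i hᵢ with arc-cases (w-step i)
  nextEntry zero    i hᵢ | inj₁ (entry , _ , class≢) = entry , class≢ , λ _ _ → z≤n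
  nextEntry (suc k) i hᵢ | inj₁ (_ , h≡1 , _)        = ⊥-elim (0≢1+n (suc-injective (trans (sym h≡1) hᵢ)))
  nextEntry zero    i hᵢ | inj₂ (_ , h≡ , _)         =
    ⊥-elim (0≢1+n (trans (suc-injective (trans (sym hᵢ) h≡)) (proj₂ (height-suc (suc i)))))
  nextEntry (suc k) i hᵢ | inj₂ (¬entry , h≡ , class≡)
    with nextEntry k (suc i) (suc-injective (trans (sym h≡) hᵢ))
  ... | entry , class≢ , first = subst Entry shift entry , class≢′ , first′
    where
    shift : ∀ {j} → w (suc j + suc i) ≡ w (suc (suc j) + i)
    shift {j} = cong (λ x → w (suc x)) (+-suc j i)
    class≢′ : class (w (suc (suc k) + i)) ≢ class (w i)
    class≢′ eq = class≢ (trans (cong class shift) (trans eq (sym class≡)))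
    first′ : ∀ j → Entry (w (suc j + i)) → suc k ≤ j
    first′ zero    entry₁ = ⊥-elim (¬entry entry₁)
    first′ (suc j) entry₂ = s≤s (first j (subst Entry (sym shift) entry₂))

  module _ (N : ℕ) (periodic : ∀ i → w (suc N + i) ≡ w i) where

    -- From an entry i the walk reaches an entry j of another class after height (w i) steps, and it can come
    -- back to the entry w i only after at least height (w j) further steps.
    lengthFromEntry : ∀ i → Entry (w i) → g ≤ suc N
    lengthFromEntry i entryᵢ with height-suc i
    ... | k , hᵢ with nextEntry k i hᵢ
    ... | entryⱼ , classⱼ≢ , firstⱼ
      with m≤n⇒m<n∨m≡n (firstⱼ N (subst Entry (sym (periodic i)) entryᵢ))
    ... | inj₂ refl = ⊥-elim (classⱼ≢ (cong class (periodic i)))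
    ... | inj₁ k<N with m≤n⇒∃[o]m+o≡n k<N
    ... | r , k+r≡N with height-suc (suc k + i)
    ... | l , hⱼ = begin
      g                              ≤⟨ gap entryᵢ entryⱼ (λ eq → classⱼ≢ (sym eq)) ⟩
      height (w i) + height (w j)    ≡⟨ cong₂ _+_ hᵢ hⱼ ⟩
      suc k + suc l                  ≤⟨ +-monoʳ-≤ (suc k) (s≤s l≤r) ⟩
      suc k + suc r                  ≡⟨ cong suc (trans (+-suc k r) k+r≡N) ⟩
      suc N                          ∎
      where
      open ≤-Reasoning
      j : ℕ
      j = suc k + i
      back : suc r + j ≡ suc N + i
      back = cong suc (trans (sym (+-assoc r (suc k) i)) (cong (_+ i) (trans (+-comm r (suc k)) k+r≡N)))
      l≤r : l ≤ r
      l≤r = proj₂ (proj₂ (nextEntry l j hⱼ)) r (subst Entry (sym (trans (cong w back) (periodic i))) entryᵢ)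

    closedWalk-length : g ≤ suc N
    closedWalk-length with height-suc 0
    ... | k , h₀ = lengthFromEntry (suc k + 0) (proj₁ (nextEntry k 0 h₀))

cycleFromℕ : ∀ {k} {R : Fin k → Fin k → Set} m (f : ℕ → Fin k) →
  (∀ j → j < m → R (f j) (f (suc j))) → R (f m) (f 0) →
  (∀ a b → a ≤ m → b ≤ m → f a ≡ f b → a ≡ b) → DirCycle R m
cycleFromℕ {R = R} m f f-step f-close f-inj = record
  { vtx   = f ∘ toℕ
  ; inj   = λ {i} {j} e → toℕ-injective (f-inj _ _ (toℕ≤pred[n] i) (toℕ≤pred[n] j) e)
  ; step  = λ i → subst (λ x → R (f x) (f (suc (toℕ i)))) (sym (toℕ-inject₁ i)) (f-step (toℕ i) (toℕ<n i))
  ; close = subst (λ x → R (f x) (f 0)) (sym (toℕ-fromℕ m)) f-close }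

module GluedPaths {k : ℕ} {R : Fin k → Fin k → Set} {K : Set} (path : K → ℕ → Fin k) (len : K → ℕ)
  (path-step : ∀ {p j} → j < len p → R (path p j) (path p (suc j)))
  (path-jump : ∀ {p q} → q ≢ p → R (path p (len p)) (path q 0))
  (path-injective : ∀ {p q i j} → i ≤ len p → j ≤ len q → path p i ≡ path q j → p ≡ q × i ≡ j)
  {p q : K} (q≢p : q ≢ p) where

  glued : ℕ → Fin k
  glued j with j ≤? len p
  ... | yes _ = path p j
  ... | no  _ = path q (j ∸ suc (len p))

  glued-onPaths : ∀ j → (∃ λ i → glued j ≡ path p i) ⊎ (∃ λ i → glued j ≡ path q i)
  glued-onPaths j with j ≤? len p
  ... | yes _ = inj₁ (_ , refl)
  ... | no  _ = inj₂ (_ , refl)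

  private
    glued-left : ∀ {j} → j ≤ len p → glued j ≡ path p j
    glued-left {j} j≤ with j ≤? len p
    ... | yes _  = refl
    ... | no  j≰ = ⊥-elim (j≰ j≤)

    glued-right : ∀ j → glued (j + suc (len p)) ≡ path q j
    glued-right j with j + suc (len p) ≤? len p
    ... | yes j≤ = ⊥-elim (<-irrefl refl (≤-trans (m≤n+m (suc (len p)) j) j≤))
    ... | no  _  = cong (path q) (m+n∸n≡m j (suc (len p)))

    side : ∀ j → j ≤ len p ⊎ ∃ λ i → j ≡ i + suc (len p)
    side j with j ≤? len p
    ... | yes j≤ = inj₁ j≤
    ... | no  j≰ = inj₂ (j ∸ suc (len p) , sym (m∸n+n≡m (≰⇒> j≰)))

    onRight : ∀ {i} → i + suc (len p) ≤ len q + suc (len p) → i ≤ len q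
    onRight {i} = +-cancelʳ-≤ (suc (len p)) i (len q)

    across : ∀ {a b x y} → glued a ≡ x → glued b ≡ y → glued a ≡ glued b → x ≡ y
    across ea eb e = trans (sym ea) (trans e eb)

  gluedCycle : DirCycle R (len q + suc (len p))
  gluedCycle = cycleFromℕ _ glued glued-step glued-close glued-injective
    where
    glued-step : ∀ j → j < len q + suc (len p) → R (glued j) (glued (suc j))
    glued-step j j<m with side j
    ... | inj₁ j≤ with m≤n⇒m<n∨m≡n j≤
    ...   | inj₁ j<     = subst₂ R (sym (glued-left j≤)) (sym (glued-left j<)) (path-step j<)
    ...   | inj₂ refl   = subst₂ R (sym (glued-left j≤)) (sym (glued-right 0)) (path-jump q≢p)
    glued-step j j<m | inj₂ (i , refl) =
      subst₂ R (sym (glued-right i)) (sym (glued-right (suc i))) (path-step (+-cancelʳ-< (suc (len p)) i (len q) j<m))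

    glued-close : R (glued (len q + suc (len p))) (glued 0)
    glued-close = subst₂ R (sym (glued-right (len q))) (sym (glued-left z≤n)) (path-jump (q≢p ∘ sym))

    glued-injective : ∀ a b → a ≤ len q + suc (len p) → b ≤ len q + suc (len p) → glued a ≡ glued b → a ≡ b
    glued-injective a b a≤ b≤ e with side a | side b
    ... | inj₁ a≤p        | inj₁ b≤p        =
      proj₂ (path-injective a≤p b≤p (across {a} {b} (glued-left a≤p) (glued-left b≤p) e))
    ... | inj₁ a≤p        | inj₂ (j , refl) = ⊥-elim (q≢p (sym (proj₁
      (path-injective a≤p (onRight b≤) (across {a} {b} (glued-left a≤p) (glued-right j) e)))))
    ... | inj₂ (i , refl) | inj₁ b≤p        =
      ⊥-elim (q≢p (proj₁ (path-injective (onRight a≤) b≤p (across {a} {b} (glued-right i) (glued-left b≤p) e))))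
    ... | inj₂ (i , refl) | inj₂ (j , refl) = cong (_+ suc (len p)) (proj₂
      (path-injective (onRight a≤) (onRight b≤) (across {a} {b} (glued-right i) (glued-right j) e)))

module _ {D : OrientedGraph} {F : Fin (n D) → Fin (n D) → Set} (F? : Decidable F) (fas : IsFAS D F)
         {m : ℕ} (C : DirCycle (Arc D) m) where
  open DirCycle C

  fas-meetsCycle : ∃ λ j → ∃ λ v → F (vtx j) v
  fas-meetsCycle with any? (λ j → F? (vtx (inject₁ j)) (vtx (suc j))) | F? (vtx (fromℕ m)) (vtx zero)
  ... | yes (j , f) | _           = inject₁ j , _ , f
  ... | no _        | yes f       = fromℕ m , _ , f
  ... | no ¬f-step  | no ¬f-close = ⊥-elim (fas m (record
    { vtx   = vtx
    ; inj   = inj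
    ; step  = λ j → step j , λ f → ¬f-step (j , f)
    ; close = close , ¬f-close }))

-- Colourings in which every colour is used twice

module _ {A B C : Set} {f : A → C} {g : B → C} where

  [,]-injective : Injective _≡_ _≡_ f → Injective _≡_ _≡_ g → (∀ a b → f a ≢ g b) →
                  Injective _≡_ _≡_ [ f , g ]′
  [,]-injective f-inj g-inj f≢g {inj₁ a} {inj₁ a′} e = cong inj₁ (f-inj e)
  [,]-injective f-inj g-inj f≢g {inj₁ a} {inj₂ b}  e = ⊥-elim (f≢g a b e)
  [,]-injective f-inj g-inj f≢g {inj₂ b} {inj₁ a}  e = ⊥-elim (f≢g a b (sym e))
  [,]-injective f-inj g-inj f≢g {inj₂ b} {inj₂ b′} e = cong inj₂ (g-inj e)

splitAt-injective : ∀ a {b} → Injective _≡_ _≡_ (splitAt a {b})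
splitAt-injective a {b} {i} {j} e = trans (sym (join-splitAt a b i)) (trans (cong (join a b) e) (join-splitAt a b j))

⊎-injective⇒≤ : ∀ {a b M} {f : Fin a ⊎ Fin b → Fin M} → Injective _≡_ _≡_ f → a + b ≤ M
⊎-injective⇒≤ {a} f-inj = injective⇒≤ (splitAt-injective a ∘ f-inj)

module _ {X : Set} {t : ℕ} (IsArc : X → Set) (colour : X → Fin t) where

  record ColourPair (i : Fin t) : Set where
    field
      first second  : X
      distinct      : first ≢ second
      first-arc     : IsArc first
      second-arc    : IsArc second
      first-colour  : colour first ≡ i
      second-colour : colour second ≡ i

  module _ {M σ : ℕ} (slot : ∀ x → IsArc x → Fin M)
    (slot-injective : ∀ {x y} (p : IsArc x) (q : IsArc y) → slot x p ≡ slot y q → x ≡ y)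
    (reserved : Fin σ → Fin M) (reserved-injective : Injective _≡_ _≡_ reserved)
    (slot≢reserved : ∀ {x} (p : IsArc x) j → slot x p ≢ reserved j)
    (pair : ∀ i → ColourPair i) where

    open module Pair i = ColourPair (pair i)

    chosen : Fin t ⊎ Fin t → X
    chosen = [ first , second ]′

    chosen-arc : ∀ c → IsArc (chosen c)
    chosen-arc (inj₁ i) = first-arc i
    chosen-arc (inj₂ i) = second-arc i

    chosen-injective : Injective _≡_ _≡_ chosen
    chosen-injective = [,]-injective
      (λ {i} {j} e → trans (sym (first-colour i)) (trans (cong colour e) (first-colour j)))
      (λ {i} {j} e → trans (sym (second-colour i)) (trans (cong colour e) (second-colour j)))
      first≢second
      where
      first≢second : ∀ i j → first i ≢ second j
      first≢second i j e with trans (sym (first-colour i)) (trans (cong colour e) (second-colour j))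
      ... | refl = distinct i e

    chosenSlot : Fin t ⊎ Fin t → Fin M
    chosenSlot c = slot (chosen c) (chosen-arc c)

    chosenSlot-injective : ∀ {c c′} → chosenSlot c ≡ chosenSlot c′ → c ≡ c′
    chosenSlot-injective {c} {c′} e = chosen-injective (slot-injective (chosen-arc c) (chosen-arc c′) e)

    colourPairs-≤ : t + t + σ ≤ M
    colourPairs-≤ = ⊎-injective⇒≤ {f = [ chosenSlot ∘ splitAt t , reserved ]′}
      ([,]-injective (λ {a} {b} e → splitAt-injective t (chosenSlot-injective {splitAt t a} {splitAt t b} e))
        reserved-injective (λ c j → slot≢reserved (chosen-arc (splitAt t c)) j))

-- The graph Θ

module Theta (P σ : ℕ) (σ<P : σ < P) where

  -- Path k occupies the positions start k … P; the vertices of class 2 below position σ are isolated.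
  start : Fin 3 → ℕ
  start (suc (suc zero)) = σ
  start _                = 0

  start≤σ : ∀ k → start k ≤ σ
  start≤σ zero             = z≤n
  start≤σ (suc zero)       = z≤n
  start≤σ (suc (suc zero)) = ≤-refl

  start<P : ∀ k → start k < P
  start<P k = ≤-<-trans (start≤σ k) σ<P

  Place : Set
  Place = Fin 3 × ℕ

  data Step : Place → Place → Set where
    along : ∀ {k a} → start k ≤ a → Step (k , a) (k , suc a)
    jump  : ∀ {k a k′ b} → a ≡ P → k′ ≢ k → b ≡ start k′ → Step (k , a) (k′ , b)

  step? : ∀ x y → Dec (Step x y)
  step? (k , a) (k′ , b) with k′ ≟ᶠ k
  ... | no k′≢k = map′ (λ (a≡P , b≡start) → jump a≡P k′≢k b≡start)
                       (λ { (along _) → ⊥-elim (k′≢k refl) ; (jump a≡P _ b≡start) → a≡P , b≡start })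
                       ((a ≟ P) ×-dec (b ≟ start k′))
  ... | yes refl with b ≟ suc a
  ...   | yes refl = map′ along (λ { (along le) → le ; (jump _ k≢k _) → ⊥-elim (k≢k refl) }) (start k ≤? a)
  ...   | no b≢1+a = no λ { (along _) → b≢1+a refl ; (jump _ k≢k _) → k≢k refl }

  step-irrefl : ∀ {x} → ¬ Step x x
  step-irrefl (jump _ k≢k _) = k≢k refl

  step-asym : ∀ {x y} → Step x y → ¬ Step y x
  step-asym (along _)          (jump _ k≢k _)  = k≢k refl
  step-asym (jump _ k′≢k _)    (along _)       = k′≢k refl
  step-asym (jump _ _ b≡start) (jump b≡P _ _) = <-irrefl (trans (sym b≡start) b≡P) (start<P _)

  Vertex : Set
  Vertex = Fin (3 * suc P)

  place : Vertex → Place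
  place u = proj₁ (remQuot {3} (suc P) u) , toℕ (proj₂ (remQuot {3} (suc P) u))

  class : Vertex → Fin 3
  class = proj₁ ∘ place

  position : Vertex → ℕ
  position = proj₂ ∘ place

  -- Meaningful only for a ≤ P; the mod merely makes vertex total.
  vertex : Fin 3 → ℕ → Vertex
  vertex k a = combine k (a mod suc P)

  position≤P : ∀ u → position u ≤ P
  position≤P u = ≤-pred (toℕ<n (proj₂ (remQuot {3} (suc P) u)))

  toℕ-mod : ∀ {a} → a ≤ P → toℕ (a mod suc P) ≡ a
  toℕ-mod a≤P = trans (toℕ-fromℕ< _) (m≤n⇒m%n≡m a≤P)

  place-vertex : ∀ {k a} → a ≤ P → place (vertex k a) ≡ (k , a)
  place-vertex {k} {a} a≤P =
    trans (cong (λ (k′ , i) → k′ , toℕ i) (remQuot-combine {3} {suc P} k (a mod suc P)))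
          (cong (k ,_) (toℕ-mod a≤P))

  class-vertex : ∀ k a → class (vertex k a) ≡ k
  class-vertex k a = cong proj₁ (remQuot-combine {3} {suc P} k (a mod suc P))

  vertex-place : ∀ u → vertex (class u) (position u) ≡ u
  vertex-place u =
    trans (cong (combine (class u)) (toℕ-injective (toℕ-mod {position u} (position≤P u))))
          (combine-remQuot {3} (suc P) u)

  place-injective : ∀ {u v} → place u ≡ place v → u ≡ v
  place-injective {u} {v} e = trans (sym (vertex-place u)) (trans (cong (uncurry vertex) e) (vertex-place v))

  Adjacent : Vertex → Vertex → Set
  Adjacent u v = Step (place u) (place v)

  adjacent? : ∀ u v → Dec (Adjacent u v)
  adjacent? u v = step? (place u) (place v)

  Θ : OrientedGraph
  Θ = fromRelation {R = Adjacent} adjacent? step-irrefl step-asym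

  arc⇒step : ∀ {u v} → Arc Θ u v → Step (place u) (place v)
  arc⇒step {u} {v} = arc⇒rel {R = Adjacent} adjacent? step-irrefl step-asym {u} {v}

  step⇒arc : ∀ {k a k′ b} → a ≤ P → b ≤ P → Step (k , a) (k′ , b) → Arc Θ (vertex k a) (vertex k′ b)
  step⇒arc {k} {a} {k′} {b} a≤P b≤P s = rel⇒arc {R = Adjacent} adjacent? step-irrefl step-asym
    {vertex k a} {vertex k′ b} (subst₂ Step (sym (place-vertex a≤P)) (sym (place-vertex b≤P)) s)

  otherClasses : Fin 3 → List (Fin 3)
  otherClasses k = map (punchIn k) (allFin 2)

  ∈-otherClasses : ∀ {k k′} → k′ ≢ k → k′ ∈ otherClasses k
  ∈-otherClasses {k} k′≢k =
    subst (_∈ otherClasses k) (punchIn-punchOut (k′≢k ∘ sym)) (∈-map⁺ (punchIn k) (∈-allFin _))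

  outdeg-≤ : ∀ u (ps : List Place) → (∀ v → Step (place u) (place v) → place v ∈ ps) →
             outdeg Θ u ≤ length ps
  outdeg-≤ u ps covers = subst (outdeg Θ u ≤_) (length-map (uncurry vertex) ps)
    (trueCount-≤ (arc Θ u) _ λ v uv →
      subst (_∈ _) (vertex-place v) (∈-map⁺ (uncurry vertex) (covers v (arc⇒step {u} {v} uv))))

  indeg-≤ : ∀ u (ps : List Place) → (∀ v → Step (place v) (place u) → place v ∈ ps) →
            indeg Θ u ≤ length ps
  indeg-≤ u ps covers = subst (indeg Θ u ≤_) (length-map (uncurry vertex) ps)
    (trueCount-≤ (λ v → arc Θ v u) _ λ v vu →
      subst (_∈ _) (vertex-place v) (∈-map⁺ (uncurry vertex) (covers v (arc⇒step {v} {u} vu))))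

  successor-inner : ∀ {k a y} → a ≢ P → Step (k , a) y → y ∈ (k , suc a) ∷ []
  successor-inner _   (along _)      = here refl
  successor-inner a≢P (jump a≡P _ _) = ⊥-elim (a≢P a≡P)

  successor-end : ∀ {k a k′ b} → a ≡ P → b ≤ P → Step (k , a) (k′ , b) →
    (k′ , b) ∈ map (λ k″ → k″ , start k″) (otherClasses k)
  successor-end refl 1+P≤P (along _)          = ⊥-elim (<-irrefl refl 1+P≤P)
  successor-end _    _     (jump _ k′≢k refl) = ∈-map⁺ _ (∈-otherClasses k′≢k)

  predecessor-inner : ∀ {x k b} → b ≢ start k → Step x (k , b) → x ∈ (k , pred b) ∷ []
  predecessor-inner _   (along _)          = here refl
  predecessor-inner b≢s (jump _ _ b≡start) = ⊥-elim (b≢s b≡start)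

  predecessor-start : ∀ {k′ a k b} → b ≡ start k → Step (k′ , a) (k , b) →
    (k′ , a) ∈ map (λ k″ → k″ , P) (otherClasses k)
  predecessor-start 1+a≡s (along s≤a)        = ⊥-elim (<-irrefl refl (≤-trans (≤-reflexive 1+a≡s) s≤a))
  predecessor-start _     (jump refl k≢k′ _) = ∈-map⁺ _ (∈-otherClasses (k≢k′ ∘ sym))

  maxDegree : MaxDegreeAtMost 3 Θ
  maxDegree u with position u ≟ P | position u ≟ start (class u)
  ... | yes end | _ = +-mono-≤
    (outdeg-≤ u _ λ v s → successor-end end (position≤P v) s)
    (indeg-≤ u _ λ v s → predecessor-inner (λ e → <-irrefl (trans (sym e) end) (start<P (class u))) s)
  ... | no ¬end | yes begin = +-mono-≤
    (outdeg-≤ u _ λ v s → successor-inner ¬end s)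
    (indeg-≤ u _ λ v s → predecessor-start begin s)
  ... | no ¬end | no ¬begin = ≤-trans (+-mono-≤
    (outdeg-≤ u _ λ v s → successor-inner ¬end s)
    (indeg-≤ u _ λ v s → predecessor-inner ¬begin s)) (n≤1+n 2)

  Entry : Vertex → Set
  Entry u = position u ≡ start (class u)

  heightAt : ℕ → ℕ
  heightAt a = suc (P ∸ a)

  height : Vertex → ℕ
  height = heightAt ∘ position

  step-cases : ∀ {k a k′ b} → Step (k , a) (k′ , b) → b ≤ P →
    (b ≡ start k′ × heightAt a ≡ 1 × k′ ≢ k) ⊎
    (b ≢ start k′ × heightAt a ≡ suc (heightAt b) × k′ ≡ k)
  step-cases (along s≤a) 1+a≤P = inj₂
    ((λ 1+a≡s → <-irrefl refl (≤-trans (≤-reflexive 1+a≡s) s≤a)) , cong (1 +_) (+-∸-assoc 1 1+a≤P) , refl)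
  step-cases (jump refl k′≢k b≡s) _ = inj₁ (b≡s , cong (1 +_) (n∸n≡0 P) , k′≢k)

  entry-gap : ∀ {k k′} → k ≢ k′ → suc P + suc (P ∸ σ) ≤ heightAt (start k) + heightAt (start k′)
  entry-gap {zero}           {zero}           0≢0 = ⊥-elim (0≢0 refl)
  entry-gap {zero}           {suc zero}       _   = +-monoʳ-≤ (suc P) (s≤s (m∸n≤m P σ))
  entry-gap {zero}           {suc (suc zero)} _   = ≤-refl
  entry-gap {suc zero}       {zero}           _   = +-monoʳ-≤ (suc P) (s≤s (m∸n≤m P σ))
  entry-gap {suc zero}       {suc zero}       1≢1 = ⊥-elim (1≢1 refl)
  entry-gap {suc zero}       {suc (suc zero)} _   = ≤-refl
  entry-gap {suc (suc zero)} {zero}           _   = ≤-reflexive (+-comm (suc P) _)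
  entry-gap {suc (suc zero)} {suc zero}       _   = ≤-reflexive (+-comm (suc P) _)
  entry-gap {suc (suc zero)} {suc (suc zero)} 2≢2 = ⊥-elim (2≢2 refl)

  girth : DirGirthAtLeast (suc P + suc (P ∸ σ)) Θ
  girth m C = closedWalk-length m (closedWalk-periodic C)
    where
    arc-cases : ∀ {u v} → Arc Θ u v →
      (Entry v × height u ≡ 1 × class v ≢ class u) ⊎
      (¬ Entry v × height u ≡ suc (height v) × class v ≡ class u)
    arc-cases {u} {v} uv = step-cases (arc⇒step {u} {v} uv) (position≤P v)

    gap : ∀ {u v} → Entry u → Entry v → class u ≢ class v → suc P + suc (P ∸ σ) ≤ height u + height v
    gap {u} {v} entryᵤ entryᵥ class≢ rewrite entryᵤ | entryᵥ = entry-gap class≢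

    open LayeredWalk (Arc Θ) class Entry height (λ {u} {v} → arc-cases {u} {v}) (λ {u} {v} → gap {u} {v})
      (closedWalk C) (closedWalk-step C)

  pathLength : Fin 3 → ℕ
  pathLength k = P ∸ start k

  pathVertex : Fin 3 → ℕ → Vertex
  pathVertex k j = vertex k (start k + j)

  start+pathLength : ∀ k → start k + pathLength k ≡ P
  start+pathLength k = m+[n∸m]≡n (<⇒≤ (start<P k))

  onPath≤P : ∀ {k j} → j ≤ pathLength k → start k + j ≤ P
  onPath≤P {k} j≤ = subst (start k + _ ≤_) (start+pathLength k) (+-monoʳ-≤ (start k) j≤)

  path-step : ∀ {k j} → j < pathLength k → Arc Θ (pathVertex k j) (pathVertex k (suc j))
  path-step {k} {j} j< = step⇒arc (onPath≤P {k} (<⇒≤ j<)) (onPath≤P {k} j<)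
    (subst (λ x → Step (k , start k + j) (k , x)) (sym (+-suc (start k) j)) (along (m≤m+n (start k) j)))

  path-jump : ∀ {k k′} → k′ ≢ k → Arc Θ (pathVertex k (pathLength k)) (pathVertex k′ 0)
  path-jump {k} {k′} k′≢k = step⇒arc (onPath≤P {k} ≤-refl) (onPath≤P {k′} z≤n)
    (jump (start+pathLength k) k′≢k (+-identityʳ (start k′)))

  path-injective : ∀ {k k′ i j} → i ≤ pathLength k → j ≤ pathLength k′ →
    pathVertex k i ≡ pathVertex k′ j → k ≡ k′ × i ≡ j
  path-injective {k} {k′} {i} {j} i≤ j≤ e =
    k≡k′ , +-cancelˡ-≡ (start k) i j (trans (cong proj₂ places≡) (cong (λ x → start x + j) (sym k≡k′)))
    where
    places≡ : (k , start k + i) ≡ (k′ , start k′ + j)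
    places≡ = trans (sym (place-vertex (onPath≤P {k} i≤)))
                    (trans (cong place e) (place-vertex (onPath≤P {k′} j≤)))
    k≡k′ : k ≡ k′
    k≡k′ = cong proj₁ places≡

  onPath-class : ∀ {x k} → (∃ λ a → x ≡ pathVertex k a) → class x ≡ k
  onPath-class {k = k} (a , refl) = class-vertex k (start k + a)

  module CycleThrough {k k′ : Fin 3} (k′≢k : k′ ≢ k) where
    open GluedPaths {R = Arc Θ} pathVertex pathLength (λ {k} {j} → path-step {k} {j}) path-jump path-injective k′≢k
      public

    glued-class : ∀ j → class (glued j) ≡ k ⊎ class (glued j) ≡ k′
    glued-class j = Sum.map onPath-class onPath-class (glued-onPaths j)

  no-common-class : ∀ {x : Fin 3} → x ≡ zero ⊎ x ≡ suc zero → x ≡ suc zero ⊎ x ≡ suc (suc zero) →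
    x ≡ zero ⊎ x ≡ suc (suc zero) → ⊥
  no-common-class (inj₁ refl) (inj₁ ()) _
  no-common-class (inj₁ refl) (inj₂ ()) _
  no-common-class (inj₂ refl) _ (inj₁ ())
  no-common-class (inj₂ refl) _ (inj₂ ())

  module Colouring {t} (c : Vertex → Vertex → Fin t)
                   (fas : ∀ i → IsFAS Θ (λ u v → Arc Θ u v × c u v ≡ i)) where

    Coloured : Fin t → Vertex × Vertex → Set
    Coloured i (u , v) = Arc Θ u v × c u v ≡ i

    ArcThrough : Fin t → Fin 3 → Fin 3 → Set
    ArcThrough i k k′ =
      Σ (Vertex × Vertex) λ e → Coloured i e × (class (proj₁ e) ≡ k ⊎ class (proj₁ e) ≡ k′)

    colouredArcThrough : ∀ i {k k′} → k′ ≢ k → ArcThrough i k k′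
    colouredArcThrough i k′≢k = hit (fas-meetsCycle {D = Θ} {F = λ u v → Coloured i (u , v)}
      (λ u v → (arc Θ u v ≟ᵇ true) ×-dec (c u v ≟ᶠ i)) (fas i) gluedCycle)
      where
      open CycleThrough k′≢k
      hit : (∃ λ j → ∃ λ v → Coloured i (glued (toℕ j) , v)) → ArcThrough i _ _
      hit (j , v , coloured) = (glued (toℕ j) , v) , coloured , glued-class (toℕ j)

    pairOf : ∀ {i e e′} → e ≢ e′ → Coloured i e → Coloured i e′ →
             ColourPair (uncurry (Arc Θ)) (uncurry c) i
    pairOf {e = e} {e′} e≢e′ (arcₑ , colourₑ) (arcₑ′ , colourₑ′) = record
      { first = e ; second = e′ ; distinct = e≢e′
      ; first-arc = arcₑ ; second-arc = arcₑ′ ; first-colour = colourₑ ; second-colour = colourₑ′ }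

    pairAmongThree : ∀ {i} → ArcThrough i zero (suc zero) → ArcThrough i (suc zero) (suc (suc zero)) →
      ArcThrough i zero (suc (suc zero)) → ColourPair (uncurry (Arc Θ)) (uncurry c) i
    pairAmongThree (e₁ , col₁ , cl₁) (e₂ , col₂ , cl₂) (e₃ , col₃ , cl₃)
      with ≡-dec _≟ᶠ_ _≟ᶠ_ e₁ e₂ | ≡-dec _≟ᶠ_ _≟ᶠ_ e₁ e₃
    ... | no e₁≢e₂ | _        = pairOf e₁≢e₂ col₁ col₂
    ... | yes refl | no e₁≢e₃ = pairOf e₁≢e₃ col₁ col₃
    ... | yes refl | yes refl = ⊥-elim (no-common-class cl₁ cl₂ cl₃)

    colourPair : ∀ i → ColourPair (uncurry (Arc Θ)) (uncurry c) i
    colourPair i =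
      pairAmongThree (colouredArcThrough i (λ ())) (colouredArcThrough i (λ ())) (colouredArcThrough i (λ ()))

  -- An arc gets the slot (class of its tail, position): along-arcs leaving position a take position a, the two
  -- jumps out of a path take P and P + 1. No arc uses the σ slots of class 2 below start 2 = σ.
  slotPosition : ∀ {x y} → Step x y → ℕ
  slotPosition (along {a = a} _)                 = a
  slotPosition (jump {k = k} {k′ = k′} _ k′≢k _) = P + toℕ (punchOut {i = k} {j = k′} (k′≢k ∘ sym))

  slotPosition< : ∀ {x k′ b} (s : Step x (k′ , b)) → b ≤ P → slotPosition s < P + 2
  slotPosition< (along _)       1+a≤P = ≤-trans 1+a≤P (m≤m+n P 2)
  slotPosition< (jump _ k′≢k _) _     = +-monoʳ-< P (toℕ<n (punchOut (k′≢k ∘ sym)))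

  start≤slotPosition : ∀ {k a y} (s : Step (k , a) y) → start k ≤ slotPosition s
  start≤slotPosition     (along s≤a)  = s≤a
  start≤slotPosition {k} (jump _ _ _) = ≤-trans (start≤σ k) (≤-trans (<⇒≤ σ<P) (m≤m+n P _))

  slotPosition-injective : ∀ {k a l b k′ a′ l′ b′} (s : Step (k , a) (l , b)) (s′ : Step (k′ , a′) (l′ , b′)) →
    k ≡ k′ → b ≤ P → b′ ≤ P → slotPosition s ≡ slotPosition s′ →
    a ≡ a′ × (l , b) ≡ (l′ , b′)
  slotPosition-injective (along _) (along _) refl _ _ refl = refl , refl
  slotPosition-injective (along _) (jump _ _ _) _ 1+a≤P _ a≡P+d =
    ⊥-elim (<-irrefl refl (≤-trans (s≤s (≤-trans (m≤m+n P _) (≤-reflexive (sym a≡P+d)))) 1+a≤P))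
  slotPosition-injective (jump _ _ _) (along _) _ _ 1+a≤P P+d≡a =
    ⊥-elim (<-irrefl refl (≤-trans (s≤s (≤-trans (m≤m+n P _) (≤-reflexive P+d≡a))) 1+a≤P))
  slotPosition-injective (jump a≡P l≢k b≡s) (jump a′≡P l′≢k b′≡s) refl _ _ P+d≡P+d′
    with punchOut-injective (l≢k ∘ sym) (l′≢k ∘ sym) (toℕ-injective (+-cancelˡ-≡ P _ _ P+d≡P+d′))
  ... | refl = trans a≡P (sym a′≡P) , cong (_ ,_) (trans b≡s (sym b′≡s))

  slot : ∀ e → uncurry (Arc Θ) e → Fin (3 * (P + 2))
  slot (u , v) uv = combine (class u) (fromℕ< (slotPosition< (arc⇒step {u} {v} uv) (position≤P v)))

  slot-injective : ∀ {e e′} (p : uncurry (Arc Θ) e) (p′ : uncurry (Arc Θ) e′) →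
                   slot e p ≡ slot e′ p′ → e ≡ e′
  slot-injective {u , v} {u′ , v′} uv u′v′ e =
    cong₂ _,_ (place-injective (cong₂ _,_ class≡ (proj₁ same))) (place-injective (proj₂ same))
    where
    s : Step (place u) (place v)
    s = arc⇒step {u} {v} uv
    s′ : Step (place u′) (place v′)
    s′ = arc⇒step {u′} {v′} u′v′
    halves : class u ≡ class u′ × fromℕ< _ ≡ fromℕ< _
    halves = combine-injective {3} {P + 2} (class u) _ (class u′) _ e
    class≡ : class u ≡ class u′
    class≡ = proj₁ halves
    same : position u ≡ position u′ × place v ≡ place v′
    same = slotPosition-injective s s′ class≡ (position≤P v) (position≤P v′)
      (trans (sym (toℕ-fromℕ< _)) (trans (cong toℕ (proj₂ halves)) (toℕ-fromℕ< _)))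

  reserved : Fin σ → Fin (3 * (P + 2))
  reserved j = combine {3} (suc (suc zero)) (inject≤ j σ≤P+2)
    where
    σ≤P+2 : σ ≤ P + 2
    σ≤P+2 = ≤-trans (<⇒≤ σ<P) (m≤m+n P 2)

  reserved-injective : ∀ {i j} → reserved i ≡ reserved j → i ≡ j
  reserved-injective {i} {j} e =
    inject≤-injective _ _ i j (proj₂ (combine-injective {3} {P + 2} (suc (suc zero)) _ (suc (suc zero)) _ e))

  slot≢reserved : ∀ {e} (p : uncurry (Arc Θ) e) j → slot e p ≢ reserved j
  slot≢reserved {u , v} uv j e with combine-injective {3} {P + 2} (class u) _ (suc (suc zero)) _ e
  ... | class≡ , position≡ =
    <-irrefl refl (≤-trans (s≤s σ≤slot) (subst (λ x → suc x ≤ σ) (sym slot≡j) (toℕ<n j)))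
    where
    s : Step (place u) (place v)
    s = arc⇒step {u} {v} uv
    σ≤slot : σ ≤ slotPosition s
    σ≤slot = subst (λ k → start k ≤ slotPosition s) class≡ (start≤slotPosition s)
    slot≡j : slotPosition s ≡ toℕ j
    slot≡j = trans (sym (toℕ-fromℕ< _)) (trans (cong toℕ position≡) (toℕ-inject≤ j _))

  fasPartition-≤ : ∀ {t} → FASPartition Θ t → t + t + σ ≤ 3 * (P + 2)
  fasPartition-≤ (c , fas) =
    colourPairs-≤ (uncurry (Arc Θ)) (uncurry c) slot (λ {e} {e′} → slot-injective {e} {e′})
      reserved (λ {i} {j} → reserved-injective {i} {j}) (λ {e} → slot≢reserved {e}) colourPair
    where open Colouring c fas

-- Choosing the parameters

fasdΔg-viaTheta : ∀ P σ {g b} → σ < P → g ≤ suc P + suc (P ∸ σ) → 3 * (P + 2) < suc b + suc b + σ →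
  FasdΔgAtMost 3 g b
fasdΔg-viaTheta P σ σ<P g≤ bound =
  Θ , maxDegree , (λ m C → ≤-trans g≤ (girth m C)) , λ partition → <⇒≱ bound (fasPartition-≤ partition)
  where open Theta P σ σ<P

fasdΔg-even : ∀ h {b} → 2 ≤ h → 3 * h + 2 ≤ b + b → FasdΔgAtMost 3 (h + h) b
fasdΔg-even _ {b} (s≤s (s≤s {n = p} _)) bound = fasdΔg-viaTheta (suc p) 0 (s≤s z≤n) ≤-refl (begin
  suc (3 * (suc p + 2))           ≡⟨ lhs p ⟩
  3 * suc (suc p) + 2 + 2         ≤⟨ +-monoˡ-≤ 2 bound ⟩
  b + b + 2                       ≡⟨ rhs b ⟩
  suc b + suc b + 0               ∎)
  where
  open ≤-Reasoning
  lhs : ∀ p → suc (3 * (suc p + 2)) ≡ 3 * suc (suc p) + 2 + 2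
  lhs = solve-∀
  rhs : ∀ b → b + b + 2 ≡ suc b + suc b + 0
  rhs = solve-∀

fasdΔg-odd : ∀ h {b} → 2 ≤ h → 3 * h + 4 ≤ b + b → FasdΔgAtMost 3 (suc (h + h)) b
fasdΔg-odd _ {b} (s≤s (s≤s {n = p} _)) bound = fasdΔg-viaTheta (suc (suc p)) 1 (s≤s (s≤s z≤n)) ≤-refl (begin
  suc (3 * (suc (suc p) + 2))     ≡⟨ lhs p ⟩
  3 * suc (suc p) + 4 + 3         ≤⟨ +-monoˡ-≤ 3 bound ⟩
  b + b + 3                       ≡⟨ rhs b ⟩
  suc b + suc b + 1               ∎)
  where
  open ≤-Reasoning
  lhs : ∀ p → suc (3 * (suc (suc p) + 2)) ≡ 3 * suc (suc p) + 4 + 3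
  lhs = solve-∀
  rhs : ∀ b → b + b + 3 ≡ suc b + suc b + 1
  rhs = solve-∀

m+m≤1+n+n⇒m≤n : ∀ {m n} → m + m ≤ suc (n + n) → m ≤ n
m+m≤1+n+n⇒m≤n {m} {n} le =
  ≮⇒≥ λ n<m → <⇒≱ (subst (_≤ m + m) (cong suc (+-suc n n)) (+-mono-≤ n<m n<m)) le

b+b-lowerBound : ∀ b q {h} c d → b + q ≡ c + (h + h) → q + q + d ≤ h → 3 * h + (c + c + d) ≤ b + b
b+b-lowerBound b q {h} c d b+q≡ q+q+d≤h = +-cancelʳ-≤ (q + q) _ _ (begin
  3 * h + (c + c + d) + (q + q)   ≡⟨ regroup h c d q ⟩
  3 * h + c + c + (q + q + d)     ≤⟨ +-monoʳ-≤ (3 * h + c + c) q+q+d≤h ⟩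
  3 * h + c + c + h               ≡⟨ double h c ⟩
  (c + (h + h)) + (c + (h + h))   ≡⟨ cong₂ _+_ (sym b+q≡) (sym b+q≡) ⟩
  (b + q) + (b + q)               ≡⟨ interchange b q ⟩
  b + b + (q + q)                 ∎)
  where
  open ≤-Reasoning
  regroup : ∀ h c d q → 3 * h + (c + c + d) + (q + q) ≡ 3 * h + c + c + (q + q + d)
  regroup = solve-∀
  double : ∀ h c → 3 * h + c + c + h ≡ (c + (h + h)) + (c + (h + h))
  double = solve-∀
  interchange : ∀ b q → (b + q) + (b + q) ≡ b + b + (q + q)
  interchange = solve-∀

m≡m%2+[m/2+m/2] : ∀ m → m ≡ m % 2 + (m / 2 + m / 2)
m≡m%2+[m/2+m/2] m = trans (m≡m%n+[m/n]*n m 2) (cong (m % 2 +_) (*2 (m / 2)))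
  where
  *2 : ∀ h → h * 2 ≡ h + h
  *2 = solve-∀

fasdΔg-evenGirth : ∀ g → g % 2 ≡ 0 → 4 ≤ g → FasdΔgAtMost 3 g (g ∸ (g / 4 ∸ 1))
fasdΔg-evenGirth g g-even 4≤g with g / 4 | m/n*n≤m g 4 | m≥n⇒m/n>0 {g} {4} 4≤g
... | suc q | [1+q]*4≤g | _ = subst (λ x → FasdΔgAtMost 3 x (g ∸ q)) (sym g≡h+h) (fasdΔg-even h 2≤h bound)
  where
  h : ℕ
  h = g / 2
  g≡h+h : g ≡ h + h
  g≡h+h = trans (m≡m%2+[m/2+m/2] g) (cong (_+ (h + h)) g-even)
  2≤h : 2 ≤ h
  2≤h = m+m≤1+n+n⇒m≤n (m≤n⇒m≤1+n (subst (4 ≤_) g≡h+h 4≤g))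
  q+q+2≤h : q + q + 2 ≤ h
  q+q+2≤h = m+m≤1+n+n⇒m≤n (m≤n⇒m≤1+n (subst₂ _≤_ (four q) g≡h+h [1+q]*4≤g))
    where
    four : ∀ q → suc q * 4 ≡ q + q + 2 + (q + q + 2)
    four = solve-∀
  q≤g : q ≤ g
  q≤g = ≤-trans (n≤1+n q) (≤-trans (m≤m*n (suc q) 4) [1+q]*4≤g)
  bound : 3 * h + 2 ≤ (g ∸ q) + (g ∸ q)
  bound = b+b-lowerBound (g ∸ q) q 0 2 (trans (m∸n+n≡m q≤g) g≡h+h) q+q+2≤h

fasdΔg-oddGirth : ∀ g → g % 2 ≡ 1 → 7 ≤ g → FasdΔgAtMost 3 g (g ∸ ((g ∸ 7) / 4))
fasdΔg-oddGirth g g-odd 7≤g = subst (λ x → FasdΔgAtMost 3 x (g ∸ q)) (sym g≡1+h+h) (fasdΔg-odd h 2≤h bound)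
  where
  q h : ℕ
  q = (g ∸ 7) / 4
  h = g / 2
  g≡1+h+h : g ≡ suc (h + h)
  g≡1+h+h = trans (m≡m%2+[m/2+m/2] g) (cong (_+ (h + h)) g-odd)
  2≤h : 2 ≤ h
  2≤h = m+m≤1+n+n⇒m≤n (≤-trans (m≤m+n 4 3) (subst (7 ≤_) g≡1+h+h 7≤g))
  q*4+7≤g : q * 4 + 7 ≤ g
  q*4+7≤g = subst (q * 4 + 7 ≤_) (m∸n+n≡m 7≤g) (+-monoˡ-≤ 7 (m/n*n≤m (g ∸ 7) 4))
  q+q+3≤h : q + q + 3 ≤ h
  q+q+3≤h = m+m≤1+n+n⇒m≤n (subst₂ _≤_ (six q) g≡1+h+h (≤-trans (+-monoʳ-≤ (q * 4) (n≤1+n 6)) q*4+7≤g))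
    where
    six : ∀ q → q * 4 + 6 ≡ q + q + 3 + (q + q + 3)
    six = solve-∀
  q≤g : q ≤ g
  q≤g = ≤-trans (m≤m*n q 4) (≤-trans (m≤m+n (q * 4) 7) q*4+7≤g)
  bound : 3 * h + 4 ≤ (g ∸ q) + (g ∸ q)
  bound = ≤-trans (+-monoʳ-≤ (3 * h) (n≤1+n 4))
                  (b+b-lowerBound (g ∸ q) q 1 3 (trans (m∸n+n≡m q≤g) g≡1+h+h) q+q+3≤h)

fasdΔg-belowGirth : ∀ g → 8 ≤ g → FasdΔgAtMost 3 g (g ∸ 1)
fasdΔg-belowGirth g 8≤g with g % 2 | m%n<n g 2 | m≡m%2+[m/2+m/2] g
... | 0 | _ | g≡h+h = subst (λ x → FasdΔgAtMost 3 x (g ∸ 1)) (sym g≡h+h)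
  (fasdΔg-even h (≤-trans (m≤m+n 2 2) 4≤h) (b+b-lowerBound (g ∸ 1) 1 0 2 (trans (m∸n+n≡m 1≤g) g≡h+h) 4≤h))
  where
  h : ℕ
  h = g / 2
  4≤h : 4 ≤ h
  4≤h = m+m≤1+n+n⇒m≤n (m≤n⇒m≤1+n (subst (8 ≤_) g≡h+h 8≤g))
  1≤g : 1 ≤ g
  1≤g = ≤-trans (m≤m+n 1 7) 8≤g
... | 1 | _ | g≡1+h+h = subst (λ x → FasdΔgAtMost 3 x (g ∸ 1)) (sym g≡1+h+h)
  (fasdΔg-odd h (≤-trans (m≤m+n 2 2) 4≤h) (b+b-lowerBound (g ∸ 1) 1 1 2 (trans (m∸n+n≡m 1≤g) g≡1+h+h) 4≤h))
  where
  h : ℕ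
  h = g / 2
  4≤h : 4 ≤ h
  4≤h = m+m≤1+n+n⇒m≤n (subst (8 ≤_) g≡1+h+h 8≤g)
  1≤g : 1 ≤ g
  1≤g = ≤-trans (m≤m+n 1 7) 8≤g
... | suc (suc _) | s≤s (s≤s ()) | _

theorem10 :
    (∀ g → g % 2 ≡ 0 → 4 ≤ g → FasdΔgAtMost 3 g (g ∸ (g / 4 ∸ 1)))
    × (∀ g → g % 2 ≡ 1 → 7 ≤ g → FasdΔgAtMost 3 g (g ∸ ((g ∸ 7) / 4)))
    × (∀ g → 8 ≤ g → FasdΔgAtMost 3 g (g ∸ 1))
theorem10 = fasdΔg-evenGirth , fasdΔg-oddGirth , fasdΔg-belowGirth
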